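{- Let $w$ be a word of even length in which each letter occurs at most twice. Suppose $|w|>2s$ and $w$ contains a framing tangled cord of order $s$ with letters $t_1,\dots,t_s$. Then there exists a non-empty subset $\sigma\subseteq\{t_1,\dots,t_s\}$ such that every word in $w\setminus\sigma$ has even length.
   Context: For a set of letters $\sigma$, $w(\sigma)$ is the word obtained by concatenating all occurrences of letters of $\sigma$ in $w$ in the order they occur in $w$, and $w\setminus\sigma$ is the sequence of non-empty subwords obtained from $w$ by deleting all occurrences of letters of $\sigma$ (the maximal contiguous blocks of $w$ containing no letter of $\sigma$). A word $w$ of length $N$ contains a framing tangled cord of order $s$ with letters $t_1,\dots,t_s$ if $w[1]=t_1$, $w[N]=t_s$, and $w(\{t_1,\dots,t_s\})=t_1t_2t_1t_3t_2\dots t_s\,t_{s-1}\,t_s$ (for $s=1$: $t_1t_1$). -}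

module Defs where

open import Data.Nat using (ℕ; zero; suc; _≟_)
open import Data.Bool using (Bool; true; false; if_then_else_; _∨_)
open import Data.List using (List; []; _∷_; _++_; length)
open import Data.Fin using (Fin; zero; suc; fromℕ; inject₁)
open import Data.Vec.Functional using (Vector)
open import Relation.Nullary.Decidable using (⌊_⌋; does)
open import Relation.Unary using (Pred; Decidable)
open import Relation.Binary.PropositionalEquality using (_≡_)
import Data.Maybe
import Data.Product
import Data.List.Base

Word : Set
Word = List ℕ

LetterSet : Set
LetterSet = ℕ → Bool

restrict : LetterSet → Word → Word
restrict σ [] = []
restrict σ (a ∷ w) = if σ a then a ∷ restrict σ w else restrict σ w

-- splitAux σ cur w : the blocks of (cur ++ w), cur being the current open block
-- (cur contains no letter of σ)
splitAux : LetterSet → Word → Word → List Word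
splitAux σ cur [] = close' cur
  where
    close' : Word → List Word
    close' [] = []
    close' (x ∷ c) = (x ∷ c) ∷ []
splitAux σ cur (a ∷ w) =
  if σ a then close'' cur (splitAux σ [] w) else splitAux σ (cur ++ (a ∷ [])) w
  where
    close'' : Word → List Word → List Word
    close'' [] bs = bs
    close'' (x ∷ c) bs = (x ∷ c) ∷ bs

-- w ∖ σ : the sequence of maximal non-empty blocks of w containing no letter of σ
delete : LetterSet → Word → List Word
delete σ w = splitAux σ [] w

occ : ℕ → Word → ℕ
occ a [] = zero
occ a (b ∷ w) = if ⌊ a ≟ b ⌋ then suc (occ a w) else occ a w

data _≤2 : ℕ → Set where
  ≤2-0 : zero ≤2
  ≤2-1 : suc zero ≤2
  ≤2-2 : suc (suc zero) ≤2

AtMostTwice : Word → Set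
AtMostTwice w = ∀ a → occ a w ≤2

-- t₁ t₂ t₁ t₃ t₂ … t_s t_{s-1} t_s  (indices 0-based: t 0 … t (s-1))
-- middle k t = t₂ t₁ t₃ t₂ … t_{k+1} t_k   (pairs t_{i} t_{i-1} for i = 2 … k+1)
cordMiddle : (k : ℕ) → (Fin (suc k) → ℕ) → Word
cordMiddle zero tt = []
cordMiddle (suc k) tt =
  cordMiddle k (λ i → tt (inject₁ i)) ++ (tt (fromℕ (suc k)) ∷ tt (inject₁ (fromℕ k)) ∷ [])

cordWord : (k : ℕ) → (Fin (suc k) → ℕ) → Word
cordWord k tt = tt zero ∷ (cordMiddle k tt ++ (tt (fromℕ k) ∷ []))

lettersOf : ∀ {s} → (Fin s → ℕ) → (Fin s → Bool) → LetterSet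
lettersOf {zero} tt σ a = false
lettersOf {suc s} tt σ a =
  (σ zero Data.Bool.∧ ⌊ a ≟ tt zero ⌋) ∨ lettersOf (λ i → tt (suc i)) (λ i → σ (suc i)) a

FramingCord : (k : ℕ) → (Fin (suc k) → ℕ) → Word → Set
FramingCord k tt w =
  (Data.List.head w ≡ Data.Maybe.just (tt zero)) Data.Product.×
  (Data.List.last w ≡ Data.Maybe.just (tt (fromℕ k))) Data.Product.×
  (restrict (lettersOf tt (λ _ → true)) w ≡ cordWord k tt)

{-# OPTIONS --safe #-}
module Submission where

-- Let the cord letters t₁ t₂ t₁ t₃ t₂ … t_s t_{s-1} t_s sit at positions c₀ < … < c_{2s-1} of w.
-- Since w starts with t₁ and ends with t_s and |w| is even, c₀ is even and c_{2s-1} is odd.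
-- The blocks of w ∖ σ are all even as soon as the positions of the σ-letters, read from left
-- to right, are alternately even and odd, starting even and ending odd.  For an interval
-- σ = {t_i, …, t_j} the σ-letters form a contiguous stretch of the cord with t_{i-1} and
-- t_{j+1} removed, so the condition only involves the pairs (t_{m+1}, t_m) of the cord:
-- the pair (t_i, t_{i-1}) starts at an even position (or i = 1), the pairs between lie at
-- (odd, even) positions, and the pair (t_{j+1}, t_j) ends at an odd position (or j = s).
-- Scanning the pairs from left to right while remembering the latest admissible start
-- always produces such an interval.  That t is injective, needed to identify the letters
-- of σ inside the cord, follows from each letter occurring at most twice.

open import Defs
open import Data.Nat using (ℕ; zero; suc; _+_; _*_; _>_; _≤_; _<_; z≤n; s≤s; _≟_; _≤?_; parity)
open import Data.Nat.Properties
  using (suc-injective; +-comm; +-suc; ≤-refl; ≤-reflexive; ≤-trans; <⇒≤; <⇒≱; n≤1+n; n<1+n;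
         m≤m+n; m≤n+m; m≤n⇒m≤1+n; m<n⇒m<1+n; m≤n⇒m<n∨m≡n; +-mono-≤; module ≤-Reasoning)
open import Data.Nat.Divisibility using (_∣_; divides-refl; ∣-refl; ∣m∣n⇒∣m+n)
open import Data.Parity.Base as ℙ using (Parity; 0ℙ; 1ℙ; _⁻¹)
open import Data.Parity.Properties using (suc-homo-⁻¹; ⁻¹-involutive; *-homo-*; *-zeroʳ; +-cancelʳ-≡)
open import Data.Bool using (Bool; true; false; _∧_; if_then_else_)
open import Data.Bool.Properties using (∨-zeroʳ; ∧-zeroʳ; ¬-not; if-float)
open import Data.Fin as Fin using (Fin; zero; suc; toℕ; fromℕ; fromℕ<; inject₁)
open import Data.Fin.Properties using (toℕ-fromℕ; toℕ-fromℕ<; toℕ-inject₁; toℕ-injective; toℕ≤pred[n])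
open import Data.List using (List; []; _∷_; _++_; _∷ʳ_; length; map; last; initLast; _∷ʳ′_)
open import Data.List.Properties
  using (length-++; length-map; map-++; map-∘; map-cong; ++-conicalʳ; ∷-injectiveʳ; ∷ʳ-injectiveˡ)
open import Data.List.Relation.Unary.All as All using (All; []; _∷_)
open import Data.List.Relation.Unary.All.Properties using (++⁺; map⁺)
open import Data.Maybe using (just)
open import Data.Maybe.Properties using (just-injective)
open import Data.Product as Product using (Σ; ∃; ∃₂; _×_; _,_)
open import Data.Sum using (_⊎_; inj₁; inj₂)
open import Function using (_∘_; id)
open import Function.Definitions using (Injective)
open import Relation.Nullary using (yes; no; contradiction)
open import Relation.Nullary.Decidable using (⌊_⌋)
open import Relation.Binary.PropositionalEquality
  using (_≡_; _≢_; refl; sym; trans; cong; cong₂; subst; subst₂; module ≡-Reasoning)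

private
  variable
    p q r : Parity
    ps qs : List Parity

parity-suc : ∀ n → parity (suc n) ≡ parity n ⁻¹
parity-suc n = trans (sym (⁻¹-involutive (parity (suc n)))) (cong _⁻¹ (suc-homo-⁻¹ n))

parity≡0ℙ⇒2∣ : ∀ n → parity n ≡ 0ℙ → 2 ∣ n
parity≡0ℙ⇒2∣ zero          _  = divides-refl 0
parity≡0ℙ⇒2∣ (suc zero)    ()
parity≡0ℙ⇒2∣ (suc (suc n)) eq = ∣m∣n⇒∣m+n ∣-refl (parity≡0ℙ⇒2∣ n eq)

2∣⇒parity≡0ℙ : ∀ {n} → 2 ∣ n → parity n ≡ 0ℙ
2∣⇒parity≡0ℙ (divides-refl q) = trans (*-homo-* q 2) (*-zeroʳ (parity q))

⁻¹-+-comm : ∀ p q → p ⁻¹ ℙ.+ q ≡ p ℙ.+ q ⁻¹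
⁻¹-+-comm 0ℙ 0ℙ = refl
⁻¹-+-comm 0ℙ 1ℙ = refl
⁻¹-+-comm 1ℙ 0ℙ = refl
⁻¹-+-comm 1ℙ 1ℙ = refl

parity-suc-+ : ∀ n p → parity (suc n) ℙ.+ p ≡ parity n ℙ.+ p ⁻¹
parity-suc-+ n p = trans (cong (ℙ._+ p) (parity-suc n)) (⁻¹-+-comm (parity n) p)

length-∷ʳ : ∀ {A : Set} (xs : List A) x → length (xs ∷ʳ x) ≡ suc (length xs)
length-∷ʳ xs x = trans (length-++ xs) (+-comm (length xs) 1)

data Alternating : Parity → Parity → List Parity → Set where
  []  : Alternating p p []
  _∷_ : ∀ p → Alternating (p ⁻¹) q ps → Alternating p q (p ∷ ps)

Alternating-++ : Alternating p q ps → Alternating q r qs → Alternating p r (ps ++ qs)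
Alternating-++ []          alt₂ = alt₂
Alternating-++ (p ∷ alt₁) alt₂ = p ∷ Alternating-++ alt₁ alt₂

Alternating-[]⁻ : Alternating p q [] → p ≡ q
Alternating-[]⁻ [] = refl

Alternating-∷⁻ : Alternating p q (r ∷ ps) → p ≡ r × Alternating (r ⁻¹) q ps
Alternating-∷⁻ (p ∷ alt) = refl , alt

parities : LetterSet → Parity → Word → List Parity
parities σ p []      = []
parities σ p (a ∷ w) = if σ a then p ∷ parities σ (p ⁻¹) w else parities σ (p ⁻¹) w

parities-∷ : ∀ σ {a} p w → σ a ≡ true → parities σ p (a ∷ w) ≡ p ∷ parities σ (p ⁻¹) w
parities-∷ σ p w σa rewrite σa = refl

parities-++ : ∀ σ p u v → parities σ p (u ++ v) ≡ parities σ p u ++ parities σ (parity (length u) ℙ.+ p) v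
parities-++ σ p []      v = refl
parities-++ σ p (a ∷ u) v =
  trans (cong (λ xs → if σ a then p ∷ xs else xs) (trans (parities-++ σ (p ⁻¹) u v)
          (cong (λ e → parities σ (p ⁻¹) u ++ parities σ e v) (sym (parity-suc-+ (length u) p)))))
        (sym (if-float (_++ parities σ (parity (suc (length u)) ℙ.+ p) v) (σ a)))

length-parities : ∀ σ p w → length (parities σ p w) ≡ length (restrict σ w)
length-parities σ p []      = refl
length-parities σ p (a ∷ w) with σ a
... | true  = cong suc (length-parities σ (p ⁻¹) w)
... | false = length-parities σ (p ⁻¹) w

splitAux-∷ : ∀ σ cur a w → splitAux σ cur (a ∷ w) ≡
             (if σ a then splitAux σ cur [] ++ splitAux σ [] w else splitAux σ (cur ∷ʳ a) w)
splitAux-∷ σ []      a w with σ a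
... | true  = refl
... | false = refl
splitAux-∷ σ (b ∷ c) a w with σ a
... | true  = refl
... | false = refl

splitAux-[]-even : ∀ σ cur → 2 ∣ length cur → All (λ u → 2 ∣ length u) (splitAux σ cur [])
splitAux-[]-even σ []      _    = []
splitAux-[]-even σ (b ∷ c) even = even ∷ []

-- Invariant: the next σ-letter must sit at a position of parity  parity |cur| + p,  where
-- p is the parity of the position of the first letter of w.
splitAux-even : ∀ σ cur p w →
                Alternating (parity (length cur) ℙ.+ p) 0ℙ (parities σ p w) →
                p ≡ parity (length w) →
                All (λ u → 2 ∣ length u) (splitAux σ cur w)
splitAux-even σ cur .0ℙ [] alt refl =
  splitAux-[]-even σ cur (parity≡0ℙ⇒2∣ _ (+-cancelʳ-≡ 0ℙ _ _ (Alternating-[]⁻ alt)))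
splitAux-even σ cur p (a ∷ w) alt p≡ rewrite splitAux-∷ σ cur a w with σ a
... | false = splitAux-even σ (cur ∷ʳ a) (p ⁻¹) w (subst (λ e → Alternating e 0ℙ _) (sym shift) alt)
                (trans (cong _⁻¹ p≡) (suc-homo-⁻¹ (length w)))
  where
    open ≡-Reasoning
    shift : parity (length (cur ∷ʳ a)) ℙ.+ p ⁻¹ ≡ parity (length cur) ℙ.+ p
    shift = begin
      parity (length (cur ∷ʳ a)) ℙ.+ p ⁻¹  ≡⟨ cong (λ n → parity n ℙ.+ p ⁻¹) (length-∷ʳ cur a) ⟩
      parity (suc (length cur)) ℙ.+ p ⁻¹   ≡⟨ parity-suc-+ (length cur) (p ⁻¹) ⟩
      parity (length cur) ℙ.+ p ⁻¹ ⁻¹      ≡⟨ cong (parity (length cur) ℙ.+_) (⁻¹-involutive p) ⟩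
      parity (length cur) ℙ.+ p            ∎
... | true with Alternating-∷⁻ alt
...   | cur+p≡p , alt′ =
  ++⁺ (splitAux-[]-even σ cur (parity≡0ℙ⇒2∣ _ (+-cancelʳ-≡ p _ 0ℙ cur+p≡p)))
      (splitAux-even σ [] (p ⁻¹) w alt′ (trans (cong _⁻¹ p≡) (suc-homo-⁻¹ (length w))))

delete-even : ∀ σ w → Alternating 0ℙ 0ℙ (parities σ 0ℙ w) → 2 ∣ length w →
              All (λ u → 2 ∣ length u) (delete σ w)
delete-even σ w alt even = splitAux-even σ [] 0ℙ w alt (sym (2∣⇒parity≡0ℙ even))

select : ∀ {A : Set} → List Bool → List A → List A
select []           _        = []
select (_     ∷ _)  []       = []
select (true  ∷ bs) (x ∷ xs) = x ∷ select bs xs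
select (false ∷ bs) (x ∷ xs) = select bs xs

select-∷-true : ∀ {A : Set} {b bs} {x : A} {xs} → b ≡ true → select (b ∷ bs) (x ∷ xs) ≡ x ∷ select bs xs
select-∷-true refl = refl

select-∷-false : ∀ {A : Set} {b bs} {x : A} {xs} → b ≡ false → select (b ∷ bs) (x ∷ xs) ≡ select bs xs
select-∷-false refl = refl

select-++ : ∀ {A : Set} (bs : List Bool) (xs : List A) {cs ys} → length bs ≡ length xs →
            select (bs ++ cs) (xs ++ ys) ≡ select bs xs ++ select cs ys
select-++ []           []       eq = refl
select-++ (true  ∷ bs) (x ∷ xs) eq = cong (x ∷_) (select-++ bs xs (suc-injective eq))
select-++ (false ∷ bs) (x ∷ xs) eq = select-++ bs xs (suc-injective eq)

select-none : ∀ {A : Set} {bs : List Bool} (xs : List A) → All (_≡ false) bs → select bs xs ≡ []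
select-none _        []           = refl
select-none []       (_ ∷ _)      = refl
select-none (x ∷ xs) (refl ∷ all) = select-none xs all

parities-restrict : ∀ {σ τ : LetterSet} → (∀ a → σ a ≡ true → τ a ≡ true) → ∀ p w →
                    parities σ p w ≡ select (map σ (restrict τ w)) (parities τ p w)
parities-restrict σ⊆τ p []      = refl
parities-restrict {σ} {τ} σ⊆τ p (a ∷ w) with σ a in σa | τ a in τa
... | true  | true  rewrite σa = cong (p ∷_) (parities-restrict σ⊆τ (p ⁻¹) w)
... | false | true  rewrite σa = parities-restrict σ⊆τ (p ⁻¹) w
... | false | false = parities-restrict σ⊆τ (p ⁻¹) w
... | true  | false with () ← trans (sym τa) (σ⊆τ a σa)

restrict-∷ : ∀ σ {a} w → σ a ≡ true → restrict σ (a ∷ w) ≡ a ∷ restrict σ w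
restrict-∷ σ w σa rewrite σa = refl

restrict-++ : ∀ σ u v → restrict σ (u ++ v) ≡ restrict σ u ++ restrict σ v
restrict-++ σ []      v = refl
restrict-++ σ (a ∷ u) v with σ a
... | true  = cong (a ∷_) (restrict-++ σ u v)
... | false = restrict-++ σ u v

restrict-∷ʳ : ∀ σ {a} w → σ a ≡ true → restrict σ (w ∷ʳ a) ≡ restrict σ w ∷ʳ a
restrict-∷ʳ σ {a} w σa = trans (restrict-++ σ w (a ∷ [])) (cong (restrict σ w ++_) (restrict-∷ σ [] σa))

lettersOf⁺ : ∀ {s} (t : Fin s → ℕ) σ i → σ i ≡ true → lettersOf t σ (t i) ≡ true
lettersOf⁺ t σ zero    σi with t zero ≟ t zero
... | yes _     rewrite σi = refl
... | no  t0≢t0 = contradiction refl t0≢t0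
lettersOf⁺ t σ (suc i) σi rewrite lettersOf⁺ (t ∘ suc) (σ ∘ suc) i σi = ∨-zeroʳ _

lettersOf⁻ : ∀ {s} (t : Fin s → ℕ) σ a → lettersOf t σ a ≡ true → ∃ λ i → σ i ≡ true × a ≡ t i
lettersOf⁻ {suc s} t σ a h with σ zero in σ0 | a ≟ t zero
... | true  | yes a≡t0 = zero , σ0 , a≡t0
... | true  | no  _    = Product.map suc id (lettersOf⁻ (t ∘ suc) (σ ∘ suc) a h)
... | false | _        = Product.map suc id (lettersOf⁻ (t ∘ suc) (σ ∘ suc) a h)

lettersOf-⊆-all : ∀ {s} (t : Fin s → ℕ) σ a → lettersOf t σ a ≡ true → lettersOf t (λ _ → true) a ≡ true
lettersOf-⊆-all t σ a h with lettersOf⁻ t σ a h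
... | i , _ , refl = lettersOf⁺ t (λ _ → true) i refl

lettersOf-∘ : ∀ {s} {t : Fin s → ℕ} → Injective _≡_ _≡_ t → ∀ σ x → lettersOf t σ (t x) ≡ σ x
lettersOf-∘ {t = t} inj σ x with σ x in σx
... | true  = lettersOf⁺ t σ x σx
... | false = ¬-not λ h → let i , σi , tx≡ti = lettersOf⁻ t σ (t x) h in
  contradiction (trans (sym σx) (trans (cong σ (inj tx≡ti)) σi)) λ ()

-- Cord positions are indexed from 0: index m stands for the letter t_{m+1}, and
-- 0 ∷ middleIndices m lists the indices of the prefix t₁ | t₂ t₁ | … | t_{m+1} t_m.
middleIndices : ℕ → List ℕ
middleIndices zero    = []
middleIndices (suc k) = middleIndices k ++ suc k ∷ k ∷ []

cordIndices : ℕ → List ℕ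
cordIndices k = 0 ∷ middleIndices k ++ k ∷ []

middleFin : (k : ℕ) → List (Fin (suc k))
middleFin zero    = []
middleFin (suc k) = map inject₁ (middleFin k) ++ fromℕ (suc k) ∷ inject₁ (fromℕ k) ∷ []

cordFin : (k : ℕ) → List (Fin (suc k))
cordFin k = zero ∷ middleFin k ++ fromℕ k ∷ []

cordMiddle≡map-middleFin : ∀ k (t : Fin (suc k) → ℕ) → cordMiddle k t ≡ map t (middleFin k)
cordMiddle≡map-middleFin zero    t = refl
cordMiddle≡map-middleFin (suc k) t = trans
  (cong (_++ t (fromℕ (suc k)) ∷ t (inject₁ (fromℕ k)) ∷ [])
        (trans (cordMiddle≡map-middleFin k (t ∘ inject₁)) (map-∘ (middleFin k))))
  (sym (map-++ t (map inject₁ (middleFin k)) _))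

cordWord≡map-cordFin : ∀ k (t : Fin (suc k) → ℕ) → cordWord k t ≡ map t (cordFin k)
cordWord≡map-cordFin k t = cong (t zero ∷_)
  (trans (cong (_++ t (fromℕ k) ∷ []) (cordMiddle≡map-middleFin k t)) (sym (map-++ t (middleFin k) _)))

map-toℕ-middleFin : ∀ k → map toℕ (middleFin k) ≡ middleIndices k
map-toℕ-middleFin zero    = refl
map-toℕ-middleFin (suc k) = trans (map-++ toℕ (map inject₁ (middleFin k)) _) (cong₂ _++_
  (trans (sym (map-∘ (middleFin k))) (trans (map-cong toℕ-inject₁ (middleFin k)) (map-toℕ-middleFin k)))
  (cong₂ (λ a b → a ∷ b ∷ []) (toℕ-fromℕ (suc k)) (trans (toℕ-inject₁ (fromℕ k)) (toℕ-fromℕ k))))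

map-toℕ-cordFin : ∀ k → map toℕ (cordFin k) ≡ cordIndices k
map-toℕ-cordFin k = cong (0 ∷_) (trans (map-++ toℕ (middleFin k) _)
  (cong₂ _++_ (map-toℕ-middleFin k) (cong (_∷ []) (toℕ-fromℕ k))))

length-cordMiddle : ∀ k (t : Fin (suc k) → ℕ) → length (cordMiddle k t) ≡ length (middleIndices k)
length-cordMiddle k t = begin
  length (cordMiddle k t)         ≡⟨ cong length (cordMiddle≡map-middleFin k t) ⟩
  length (map t (middleFin k))    ≡⟨ length-map t (middleFin k) ⟩
  length (middleFin k)            ≡⟨ sym (length-map toℕ (middleFin k)) ⟩
  length (map toℕ (middleFin k))  ≡⟨ cong length (map-toℕ-middleFin k) ⟩
  length (middleIndices k)        ∎
  where open ≡-Reasoning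

cord-mask : ∀ {k} {t : Fin (suc k) → ℕ} → Injective _≡_ _≡_ t → ∀ (g : ℕ → Bool) →
            map (lettersOf t (g ∘ toℕ)) (cordWord k t) ≡ map g (cordIndices k)
cord-mask {k} {t} inj g = begin
  map (lettersOf t (g ∘ toℕ)) (cordWord k t)       ≡⟨ cong (map _) (cordWord≡map-cordFin k t) ⟩
  map (lettersOf t (g ∘ toℕ)) (map t (cordFin k))  ≡⟨ sym (map-∘ (cordFin k)) ⟩
  map (lettersOf t (g ∘ toℕ) ∘ t) (cordFin k)      ≡⟨ map-cong (lettersOf-∘ inj (g ∘ toℕ)) (cordFin k) ⟩
  map (g ∘ toℕ) (cordFin k)                        ≡⟨ map-∘ (cordFin k) ⟩
  map g (map toℕ (cordFin k))                      ≡⟨ cong (map g) (map-toℕ-cordFin k) ⟩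
  map g (cordIndices k)                            ∎
  where open ≡-Reasoning

occ-hit : ∀ {a b} l → a ≡ b → occ a (b ∷ l) ≡ suc (occ a l)
occ-hit {a} l refl with a ≟ a
... | yes _  = refl
... | no a≢a = contradiction refl a≢a

occ-∷-≤ : ∀ a b l → occ a l ≤ occ a (b ∷ l)
occ-∷-≤ a b l with ⌊ a ≟ b ⌋
... | true  = n≤1+n _
... | false = ≤-refl

occ-∷-mono : ∀ a b {l l′} → occ a l ≤ occ a l′ → occ a (b ∷ l) ≤ occ a (b ∷ l′)
occ-∷-mono a b l≤l′ with ⌊ a ≟ b ⌋
... | true  = s≤s l≤l′
... | false = l≤l′

occ-++ : ∀ a xs ys → occ a (xs ++ ys) ≡ occ a xs + occ a ys
occ-++ a []       ys = refl
occ-++ a (b ∷ xs) ys with ⌊ a ≟ b ⌋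
... | true  = cong suc (occ-++ a xs ys)
... | false = occ-++ a xs ys

occ-++-≤ˡ : ∀ a xs ys → occ a xs ≤ occ a (xs ++ ys)
occ-++-≤ˡ a xs ys = subst (occ a xs ≤_) (sym (occ-++ a xs ys)) (m≤m+n _ _)

occ-++-≤ʳ : ∀ a xs ys → occ a ys ≤ occ a (xs ++ ys)
occ-++-≤ʳ a xs ys = subst (occ a ys ≤_) (sym (occ-++ a xs ys)) (m≤n+m _ _)

occ-restrict-≤ : ∀ σ a w → occ a (restrict σ w) ≤ occ a w
occ-restrict-≤ σ a []      = z≤n
occ-restrict-≤ σ a (b ∷ w) with σ b
... | true  = occ-∷-mono a b {restrict σ w} {w} (occ-restrict-≤ σ a w)
... | false = ≤-trans (occ-restrict-≤ σ a w) (occ-∷-≤ a b w)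

occ-last-middleIndices : ∀ k → 1 ≤ occ k (0 ∷ middleIndices k)
occ-last-middleIndices zero    = ≤-refl
occ-last-middleIndices (suc k) = ≤-trans (subst (1 ≤_) (sym (occ-hit {suc k} (k ∷ []) refl)) (s≤s z≤n))
  (occ-++-≤ʳ (suc k) (0 ∷ middleIndices k) (suc k ∷ k ∷ []))

occ-middleIndices : ∀ {m k} → m < k → 2 ≤ occ m (0 ∷ middleIndices k)
occ-middleIndices {m} {suc k} (s≤s m≤k) with m≤n⇒m<n∨m≡n m≤k
... | inj₁ m<k  = ≤-trans (occ-middleIndices m<k) (occ-++-≤ˡ m (0 ∷ middleIndices k) _)
... | inj₂ refl = subst (2 ≤_) (sym (occ-++ m (0 ∷ middleIndices m) (suc m ∷ m ∷ [])))
  (+-mono-≤ (occ-last-middleIndices m)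
            (≤-trans (≤-reflexive (sym (occ-hit {m} [] refl))) (occ-∷-≤ m (suc m) (m ∷ []))))

occ-cordIndices : ∀ {m k} → m ≤ k → 2 ≤ occ m (cordIndices k)
occ-cordIndices {m} {k} m≤k with m≤n⇒m<n∨m≡n m≤k
... | inj₁ m<k  = ≤-trans (occ-middleIndices m<k) (occ-++-≤ˡ m (0 ∷ middleIndices k) (k ∷ []))
... | inj₂ refl = subst (2 ≤_) (sym (occ-++ m (0 ∷ middleIndices m) (m ∷ [])))
  (+-mono-≤ (occ-last-middleIndices m) (≤-reflexive (sym (occ-hit {m} [] refl))))

occ-map-toℕ : ∀ {n} (g : Fin n → ℕ) {x y} → x ≢ y → g x ≡ g y → ∀ l →
              occ (toℕ x) (map toℕ l) + occ (toℕ y) (map toℕ l) ≤ occ (g x) (map g l)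
occ-map-toℕ g x≢y gx≡gy [] = z≤n
occ-map-toℕ g {x} {y} x≢y gx≡gy (z ∷ l) with toℕ x ≟ toℕ z | toℕ y ≟ toℕ z
... | yes x≡z | yes y≡z = contradiction (toℕ-injective (trans x≡z (sym y≡z))) x≢y
... | yes x≡z | no  _   =
  subst (_ ≤_) (sym (occ-hit (map g l) (cong g (toℕ-injective x≡z))))
        (s≤s (occ-map-toℕ g x≢y gx≡gy l))
... | no  _   | yes y≡z =
  subst₂ _≤_ (sym (+-suc _ _)) (sym (occ-hit (map g l) (trans gx≡gy (cong g (toℕ-injective y≡z)))))
        (s≤s (occ-map-toℕ g x≢y gx≡gy l))
... | no  _   | no  _   = ≤-trans (occ-map-toℕ g x≢y gx≡gy l) (occ-∷-≤ (g x) (g z) (map g l))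

≤2⇒≤ : ∀ {n} → n ≤2 → n ≤ 2
≤2⇒≤ ≤2-0 = z≤n
≤2⇒≤ ≤2-1 = s≤s z≤n
≤2⇒≤ ≤2-2 = s≤s (s≤s z≤n)

cord-injective : ∀ {k} {t : Fin (suc k) → ℕ} {τ w} →
                 AtMostTwice w → restrict τ w ≡ cordWord k t → Injective _≡_ _≡_ t
cord-injective {k} {t} {τ} {w} twice rs {x} {y} tx≡ty with x Fin.≟ y
... | yes x≡y = x≡y
... | no  x≢y = contradiction (≤-trans four≤ (≤2⇒≤ (twice (t x)))) λ { (s≤s (s≤s ())) }
  where
    open ≤-Reasoning
    four≤ : 4 ≤ occ (t x) w
    four≤ = begin
      4
        ≤⟨ +-mono-≤ (occ-cordIndices (toℕ≤pred[n] x)) (occ-cordIndices (toℕ≤pred[n] y)) ⟩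
      occ (toℕ x) (cordIndices k) + occ (toℕ y) (cordIndices k)
        ≡⟨ cong (λ l → occ (toℕ x) l + occ (toℕ y) l) (sym (map-toℕ-cordFin k)) ⟩
      occ (toℕ x) (map toℕ (cordFin k)) + occ (toℕ y) (map toℕ (cordFin k))
        ≤⟨ occ-map-toℕ t x≢y tx≡ty (cordFin k) ⟩
      occ (t x) (map t (cordFin k))
        ≡⟨ cong (occ (t x)) (sym (trans rs (cordWord≡map-cordFin k t))) ⟩
      occ (t x) (restrict τ w)
        ≤⟨ occ-restrict-≤ τ (t x) w ⟩
      occ (t x) w
        ∎

inInterval : ℕ → ℕ → ℕ → Bool
inInterval i j m = ⌊ i ≤? m ⌋ ∧ ⌊ m ≤? j ⌋

inInterval-inside : ∀ {i j m} → i ≤ m → m ≤ j → inInterval i j m ≡ true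
inInterval-inside {i} {j} {m} i≤m m≤j with i ≤? m | m ≤? j
... | yes _   | yes _   = refl
... | no  i≰m | _       = contradiction i≤m i≰m
... | yes _   | no  m≰j = contradiction m≤j m≰j

inInterval-below : ∀ {i j m} → m < i → inInterval i j m ≡ false
inInterval-below {i} {j} {m} m<i with i ≤? m
... | yes i≤m = contradiction i≤m (<⇒≱ m<i)
... | no  _   = refl

inInterval-above : ∀ {i j m} → j < m → inInterval i j m ≡ false
inInterval-above {i} {j} {m} j<m with m ≤? j
... | yes m≤j = contradiction m≤j (<⇒≱ j<m)
... | no  _   = ∧-zeroʳ _

-- Opaque, so that goals stay in terms of selected instead of unfolding into select and map.
opaque
  selected : ℕ → ℕ → List ℕ → List Parity → List Parity
  selected i j ns = select (map (inInterval i j) ns)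

opaque
  unfolding selected

  select-map-inInterval : ∀ i j ns ps → select (map (inInterval i j) ns) ps ≡ selected i j ns ps
  select-map-inInterval i j ns ps = refl

  selected-[] : ∀ i j ps → selected i j [] ps ≡ []
  selected-[] i j ps = refl

  selected-∷-inside : ∀ {i j n ns p ps} → i ≤ n → n ≤ j →
                      selected i j (n ∷ ns) (p ∷ ps) ≡ p ∷ selected i j ns ps
  selected-∷-inside {i} {j} {n} i≤n n≤j = select-∷-true (inInterval-inside {i} {j} {n} i≤n n≤j)

  selected-∷-below : ∀ {i j n ns p ps} → n < i → selected i j (n ∷ ns) (p ∷ ps) ≡ selected i j ns ps
  selected-∷-below {i} {j} {n} n<i = select-∷-false (inInterval-below {i} {j} {n} n<i)

  selected-∷-above : ∀ {i j n ns p ps} → j < n → selected i j (n ∷ ns) (p ∷ ps) ≡ selected i j ns ps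
  selected-∷-above {i} {j} {n} j<n = select-∷-false (inInterval-above {i} {j} {n} j<n)

  selected-++ : ∀ i j ns ps {ms qs} → length ns ≡ length ps →
                selected i j (ns ++ ms) (ps ++ qs) ≡ selected i j ns ps ++ selected i j ms qs
  selected-++ i j ns ps {ms} {qs} eq =
    trans (cong (λ bs → select bs (ps ++ qs)) (map-++ (inInterval i j) ns ms))
          (select-++ (map (inInterval i j) ns) ps (trans (length-map (inInterval i j) ns) eq))

  selected-below : ∀ {i j ns} ps → All (_< i) ns → selected i j ns ps ≡ []
  selected-below ps ns<i = select-none ps (map⁺ (All.map inInterval-below ns<i))

middleIndices-≤ : ∀ k → All (_≤ k) (0 ∷ middleIndices k)
middleIndices-≤ zero    = z≤n ∷ []
middleIndices-≤ (suc k) = ++⁺ (All.map m≤n⇒m≤1+n (middleIndices-≤ k)) (≤-refl ∷ n≤1+n k ∷ [])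

split-last-two : ∀ {A B : Set} (xs : List A) (ys : List B) {y₁ y₂} →
                 length xs ≡ length (ys ++ y₁ ∷ y₂ ∷ []) →
                 ∃ λ zs → ∃₂ λ a b → xs ≡ zs ++ a ∷ b ∷ [] × length zs ≡ length ys
split-last-two []               []       ()
split-last-two (_ ∷ [])         []       ()
split-last-two (a ∷ b ∷ [])     []       refl = [] , a , b , refl , refl
split-last-two (_ ∷ _ ∷ _ ∷ _)  []       ()
split-last-two []               (_ ∷ _)  ()
split-last-two (x ∷ xs)         (y ∷ ys) eq with split-last-two xs ys (suc-injective eq)
... | zs , a , b , refl , len = x ∷ zs , a , b , refl , cong suc len

module _ {m : ℕ} {a b : Parity} where

  pair-outside : ∀ {i j} → j < m → selected i j (suc m ∷ m ∷ []) (a ∷ b ∷ []) ≡ []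
  pair-outside {i} {j} j<m = trans (selected-∷-above (m<n⇒m<1+n j<m))
    (trans (selected-∷-above j<m) (selected-[] i j []))

  pair-last : ∀ {i} → i ≤ m → selected i m (suc m ∷ m ∷ []) (a ∷ b ∷ []) ≡ b ∷ []
  pair-last {i} i≤m = trans (selected-∷-above (n<1+n m))
    (trans (selected-∷-inside i≤m ≤-refl) (cong (b ∷_) (selected-[] i m [])))

  pair-inside : ∀ {i j} → i ≤ m → m < j → selected i j (suc m ∷ m ∷ []) (a ∷ b ∷ []) ≡ a ∷ b ∷ []
  pair-inside {i} {j} i≤m m<j = trans (selected-∷-inside (m≤n⇒m≤1+n i≤m) m<j)
    (cong (a ∷_) (trans (selected-∷-inside i≤m (<⇒≤ m<j)) (cong (b ∷_) (selected-[] i j []))))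

  pair-first : ∀ {j} → m < j → selected (suc m) j (suc m ∷ m ∷ []) (a ∷ b ∷ []) ≡ a ∷ []
  pair-first {j} m<j = trans (selected-∷-inside ≤-refl m<j)
    (cong (a ∷_) (trans (selected-∷-below (n<1+n m)) (selected-[] (suc m) j [])))

Alternating-selected-++ : ∀ {i j ns ps ms qs p q r} → length ns ≡ length ps →
                          Alternating p q (selected i j ns ps) → Alternating q r (selected i j ms qs) →
                          Alternating p r (selected i j (ns ++ ms) (ps ++ qs))
Alternating-selected-++ {i} {j} {ns} {ps} eq alt₁ alt₂ =
  subst (Alternating _ _) (sym (selected-++ i j ns ps eq)) (Alternating-++ alt₁ alt₂)

-- The two states of the left-to-right scan over the first m pairs of the cord, π being the
-- parities of their positions: an interval already completed, or a start i still open.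
ClosedInterval : ℕ → List Parity → Set
ClosedInterval m π =
  ∃₂ λ i j → i ≤ j × j < m × Alternating 0ℙ 0ℙ (selected i j (0 ∷ middleIndices m) π)

OpenInterval : ℕ → List Parity → Set
OpenInterval m π =
  ∃ λ i → i ≤ m × ∀ j → m ≤ j → Alternating 0ℙ 1ℙ (selected i j (0 ∷ middleIndices m) π)

prefix-interval : ∀ m ρ → length ρ ≡ length (middleIndices m) →
                  ClosedInterval m (0ℙ ∷ ρ) ⊎ OpenInterval m (0ℙ ∷ ρ)
prefix-interval zero    [] refl = inj₂ (0 , z≤n , λ j _ → subst (Alternating 0ℙ 1ℙ)
  (sym (trans (selected-∷-inside z≤n z≤n) (cong (0ℙ ∷_) (selected-[] 0 j [])))) (0ℙ ∷ []))
prefix-interval (suc m) ρ′ len′ with split-last-two ρ′ (middleIndices m) len′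
... | ρ , a , b , refl , len with prefix-interval m ρ len
...   | inj₁ (i , j , i≤j , j<m , alt) = inj₁ (i , j , i≤j , m<n⇒m<1+n j<m ,
          Alternating-selected-++ (cong suc (sym len)) alt
            (subst (Alternating 0ℙ 0ℙ) (sym (pair-outside j<m)) []))
-- a and b are the parities of the new pair (t_{m+2}, t_{m+1}): an odd b closes the open
-- interval, (odd, even) extends it, and (even, even) makes m + 1 the new start.
...   | inj₂ (i , i≤m , alt) with a | b
...     | _  | 1ℙ = inj₁ (i , m , i≤m , n<1+n m ,
          Alternating-selected-++ (cong suc (sym len)) (alt m ≤-refl)
            (subst (Alternating 1ℙ 0ℙ) (sym (pair-last i≤m)) (1ℙ ∷ [])))
...     | 1ℙ | 0ℙ = inj₂ (i , m≤n⇒m≤1+n i≤m , λ j m<j →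
          Alternating-selected-++ (cong suc (sym len)) (alt j (<⇒≤ m<j))
            (subst (Alternating 1ℙ 1ℙ) (sym (pair-inside i≤m m<j)) (1ℙ ∷ 0ℙ ∷ [])))
...     | 0ℙ | 0ℙ = inj₂ (suc m , ≤-refl , λ j m<j →
          Alternating-selected-++ (cong suc (sym len))
            (subst (Alternating 0ℙ 0ℙ)
                   (sym (selected-below (0ℙ ∷ ρ) (All.map s≤s (middleIndices-≤ m)))) [])
            (subst (Alternating 0ℙ 1ℙ) (sym (pair-first m<j)) (0ℙ ∷ [])))

cord-interval : ∀ k ρ → length ρ ≡ length (middleIndices k) →
                ∃₂ λ i j → i ≤ j × j ≤ k ×
                           Alternating 0ℙ 0ℙ (selected i j (cordIndices k) (0ℙ ∷ ρ ++ 1ℙ ∷ []))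
cord-interval k ρ len with prefix-interval k ρ len
... | inj₁ (i , j , i≤j , j<k , alt) = i , j , i≤j , <⇒≤ j<k ,
      Alternating-selected-++ (cong suc (sym len)) alt
        (subst (Alternating 0ℙ 0ℙ) (sym (trans (selected-∷-above j<k) (selected-[] i j []))) [])
... | inj₂ (i , i≤k , alt) = i , k , i≤k , ≤-refl ,
      Alternating-selected-++ (cong suc (sym len)) (alt k ≤-refl)
        (subst (Alternating 1ℙ 0ℙ)
               (sym (trans (selected-∷-inside i≤k ≤-refl) (cong (1ℙ ∷_) (selected-[] i k [])))) (1ℙ ∷ []))

last-∷ʳ : ∀ {A : Set} (xs : List A) x → last (xs ∷ʳ x) ≡ just x
last-∷ʳ []           x = refl
last-∷ʳ (_ ∷ [])     x = refl
last-∷ʳ (_ ∷ y ∷ xs) x = last-∷ʳ (y ∷ xs) x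

cord-parities : ∀ k (t : Fin (suc k) → ℕ) w → FramingCord k t w → 2 ∣ length w →
                ∃ λ ρ → length ρ ≡ length (middleIndices k) ×
                        parities (lettersOf t (λ _ → true)) 0ℙ w ≡ 0ℙ ∷ ρ ++ 1ℙ ∷ []
cord-parities k t [] (() , _)
cord-parities k t (.(t zero) ∷ w) (refl , lst , rs) even with initLast w
... | [] with () ← ++-conicalʳ (cordMiddle k t) _ (sym (∷-injectiveʳ (trans (sym
                     (restrict-∷ (lettersOf t (λ _ → true)) [] (lettersOf⁺ t (λ _ → true) zero refl))) rs)))
... | u ∷ʳ′ a with refl ← just-injective (trans (sym (last-∷ʳ (t zero ∷ u) a)) lst) =
  parities T 1ℙ u , len ,
  trans (parities-∷ T 0ℙ (u ∷ʳ a) (T-t zero))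
        (cong (0ℙ ∷_) (trans (parities-++ T 1ℙ u (a ∷ [])) (cong (parities T 1ℙ u ++_) last-parity)))
  where
    T : LetterSet
    T = lettersOf t (λ _ → true)
    T-t : ∀ i → T (t i) ≡ true
    T-t i = lettersOf⁺ t (λ _ → true) i refl
    restrict-u : restrict T u ≡ cordMiddle k t
    restrict-u = ∷ʳ-injectiveˡ (restrict T u) (cordMiddle k t) (∷-injectiveʳ (trans (sym
      (trans (restrict-∷ T (u ∷ʳ a) (T-t zero)) (cong (t zero ∷_) (restrict-∷ʳ T u (T-t (fromℕ k)))))) rs))
    len : length (parities T 1ℙ u) ≡ length (middleIndices k)
    len = trans (length-parities T 1ℙ u) (trans (cong length restrict-u) (length-cordMiddle k t))
    u-even : parity (length u) ≡ 0ℙ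
    u-even = trans (cong (parity ∘ suc) (sym (length-∷ʳ u a))) (2∣⇒parity≡0ℙ even)
    last-parity : parities T (parity (length u) ℙ.+ 1ℙ) (a ∷ []) ≡ 1ℙ ∷ []
    last-parity = trans (parities-∷ T _ [] (T-t (fromℕ k))) (cong (λ e → e ℙ.+ 1ℙ ∷ []) u-even)

interval-parities : ∀ {k} {t : Fin (suc k) → ℕ} {w} p → AtMostTwice w →
                    restrict (lettersOf t (λ _ → true)) w ≡ cordWord k t → ∀ i j →
                    parities (lettersOf t (inInterval i j ∘ toℕ)) p w ≡
                    selected i j (cordIndices k) (parities (lettersOf t (λ _ → true)) p w)
interval-parities {k} {t} {w} p twice rs i j = begin
  parities (lettersOf t σ) p w
    ≡⟨ parities-restrict (lettersOf-⊆-all t σ) p w ⟩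
  select (map (lettersOf t σ) (restrict T w)) (parities T p w)
    ≡⟨ cong (λ bs → select bs (parities T p w)) mask ⟩
  select (map (inInterval i j) (cordIndices k)) (parities T p w)
    ≡⟨ select-map-inInterval i j (cordIndices k) _ ⟩
  selected i j (cordIndices k) (parities T p w)
    ∎
  where
    open ≡-Reasoning
    σ = inInterval i j ∘ toℕ
    T = lettersOf t (λ _ → true)
    mask : map (lettersOf t σ) (restrict T w) ≡ map (inInterval i j) (cordIndices k)
    mask = trans (cong (map _) rs) (cord-mask (cord-injective {τ = T} {w} twice rs) (inInterval i j))

lemma4p6 : (k : ℕ) (t : Fin (suc k) → ℕ) (w : Word)
    → 2 ∣ length w
    → AtMostTwice w
    → length w > 2 * suc k
    → FramingCord k t w
    → Σ (Fin (suc k) → Bool) λ σ →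
        (∃ λ i → σ i ≡ true)
        × All (λ u → 2 ∣ length u) (delete (lettersOf t σ) w)
lemma4p6 k t w even twice _ cord@(_ , _ , rs) with cord-parities k t w cord even
... | ρ , len , parities≡ with cord-interval k ρ len
...   | i , j , i≤j , j≤k , alt = σ , (fromℕ< i<1+k , σi) , delete-even (lettersOf t σ) w alt′ even
  where
    σ : Fin (suc k) → Bool
    σ = inInterval i j ∘ toℕ
    i<1+k : i < suc k
    i<1+k = s≤s (≤-trans i≤j j≤k)
    σi : σ (fromℕ< i<1+k) ≡ true
    σi = trans (cong (inInterval i j) (toℕ-fromℕ< i<1+k)) (inInterval-inside ≤-refl i≤j)
    alt′ : Alternating 0ℙ 0ℙ (parities (lettersOf t σ) 0ℙ w)
    alt′ = subst (Alternating 0ℙ 0ℙ) (sym (trans (interval-parities {t = t} {w} 0ℙ twice rs i j)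
                                                 (cong (selected i j (cordIndices k)) parities≡))) alt
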